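{- Let $G$ be a graph on $n$ vertices. If $i \ge \frac{n+\Gamma(G)-1}{2}$, then $d_i(G) \ge d_{i+1}(G)$.
   Context: $G$ is a finite simple graph. A set $U\subseteq V(G)$ is dominating if every vertex is in $U$ or adjacent to a vertex of $U$; $d_i(G)$ denotes the number of dominating sets of $G$ of size $i$ (so $d_i(G)=0$ for $i>n$). A dominating set is minimal if no proper subset of it is dominating. The upper domination number $\Gamma(G)$ is the maximum size of a minimal dominating set of $G$. -}

module Defs where

open import Data.Nat using (ℕ; zero; suc; _≟_)
open import Data.Bool using (Bool; true; false)
open import Data.Fin using (Fin)
open import Data.Fin.Subset using (Subset; _∈_; _⊂_; ∣_∣)
open import Data.Fin.Subset.Properties using (_∈?_)
open import Data.Fin.Properties using (any?; all?)
open import Data.Vec using (_∷_; [])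
open import Data.List using (List; []; _∷_; map; _++_; filter; length)
open import Data.Product using (Σ; ∃; _×_; _,_)
open import Data.Sum using (_⊎_)
open import Relation.Nullary using (¬_; Dec)
open import Relation.Nullary.Decidable using (_⊎-dec_; _×-dec_)
open import Relation.Binary.PropositionalEquality using (_≡_)
open import Data.Bool.Properties using () renaming (_≟_ to _≟ᵇ_)

record Graph (n : ℕ) : Set where
  field
    adj   : Fin n → Fin n → Bool
    sym   : ∀ u v → adj u v ≡ adj v u
    irref : ∀ v → adj v v ≡ false
open Graph public

Dominating : ∀ {n} → Graph n → Subset n → Set
Dominating G U = ∀ v → v ∈ U ⊎ (∃ λ u → u ∈ U × adj G u v ≡ true)

dominating? : ∀ {n} (G : Graph n) (U : Subset n) → Dec (Dominating G U)
dominating? G U = all? λ v → (v ∈? U) ⊎-dec any? (λ u → (u ∈? U) ×-dec (adj G u v ≟ᵇ true))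

MinimalDominating : ∀ {n} → Graph n → Subset n → Set
MinimalDominating G U = Dominating G U × (∀ W → W ⊂ U → ¬ Dominating G W)

IsUpperDominationNumber : ∀ {n} → Graph n → ℕ → Set
IsUpperDominationNumber G Γ =
  (Σ _ λ U → MinimalDominating G U × ∣ U ∣ ≡ Γ) ×
  (∀ U → MinimalDominating G U → ∣ U ∣ Data.Nat.≤ Γ)

allSubsets : ∀ n → List (Subset n)
allSubsets zero = [] ∷ []
allSubsets (suc n) = map (true ∷_) (allSubsets n) ++ map (false ∷_) (allSubsets n)

d : ∀ {n} → ℕ → Graph n → ℕ
d i G = length (filter (λ U → dominating? G U ×-dec (∣ U ∣ ≟ i)) (allSubsets _))

-- Count the pairs (S , v) with v ∈ S, S a dominating set of size i + 1 and S − v a dominating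
-- set of size i. Such a pair is the same as a dominating set T = S − v of size i together with
-- one of the n − i vertices outside T, so there are exactly (n − i) d_i(G) of them. On the
-- other hand S contains a minimal dominating set M, so |M| ≤ Γ, and deleting any vertex of
-- S ∖ M leaves a dominating set; as |S ∖ M| ≥ i + 1 − Γ ≥ n − i, there are at least
-- (n − i) d_{i+1}(G) pairs. If i ≥ n there is no set of size i + 1 at all.

module Submission where

open import Defs hiding (sym)
open import Data.Nat.Base using (ℕ; zero; suc; _+_; _*_; _∸_; _≤_; _<_; z≤n; s≤s; >-nonZero)
open import Data.Nat.Properties
open import Data.Nat.Induction using (<-wellFounded)
open import Data.Nat.Tactic.RingSolver using (solve-∀)
open import Data.Bool using (Bool; true; false; _∧_; not)
import Data.Fin as Fin
open Fin using (Fin)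
open import Data.Fin.Subset using (Subset; _⊆_; _⊂_; ∣_∣; ∁; inside; outside)
open import Data.Fin.Subset.Properties
  using (∣p∣≤n; ∣∁p∣≡n∸∣p∣; ⊆-refl; ⊆-trans; p⊂q⇒∣p∣<∣q∣; _⊂?_; anySubset?)
open import Data.Vec using (lookup; _[_]≔_; _∷_; [])
open import Data.Vec.Properties using ([]=⇒lookup; []≔-minimal)
import Data.List as List
open List using (map; _++_; filter; length)
open import Data.List.Properties using (length-++; filter-++)
open import Data.Product using (∃-syntax; _×_; _,_; proj₁)
open import Data.Sum using (inj₁; inj₂)
open import Function using (_∘_)
open import Induction.WellFounded using (Acc; acc)
open import Relation.Nullary using (¬_; Dec; yes; no; does; contradiction)
open import Relation.Nullary.Decidable using (dec-true; dec-false; _×-dec_)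
open import Relation.Unary using (Pred; Decidable)
open import Relation.Binary.PropositionalEquality
open import Algebra.Properties.Semiring.Sum +-*-semiring
  using (sum-syntax; ∑-distrib-+; sum-cong-≗; *-distribʳ-sum)

𝟙 : Bool → ℕ
𝟙 true  = 1
𝟙 false = 0

*-𝟙-≤ : ∀ {p} {P : Set p} {c x : ℕ} (P? : Dec P) → (P → c ≤ x) → c * 𝟙 (does P?) ≤ x
*-𝟙-≤ {c = c} (yes p) c≤x = ≤-trans (≤-reflexive (*-identityʳ c)) (c≤x p)
*-𝟙-≤ {c = c} (no _)  _   = ≤-trans (≤-reflexive (*-zeroʳ c)) z≤n

*-𝟙-cong : ∀ {p} {P : Set p} {x y : ℕ} (P? : Dec P) → (P → x ≡ y) → x * 𝟙 (does P?) ≡ y * 𝟙 (does P?)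
*-𝟙-cong (yes p) x≡y = cong (_* 1) (x≡y p)
*-𝟙-cong {x = x} {y} (no _) _ = trans (*-zeroʳ x) (sym (*-zeroʳ y))

∑-mono-≤ : ∀ {n} {f g : Fin n → ℕ} → (∀ v → f v ≤ g v) → ∑[ v < n ] f v ≤ ∑[ v < n ] g v
∑-mono-≤ {zero}  f≤g = z≤n
∑-mono-≤ {suc n} f≤g = +-mono-≤ (f≤g Fin.zero) (∑-mono-≤ (f≤g ∘ Fin.suc))

∣p∣≡∑𝟙 : ∀ {n} (p : Subset n) → ∣ p ∣ ≡ ∑[ v < n ] 𝟙 (lookup p v)
∣p∣≡∑𝟙 []            = refl
∣p∣≡∑𝟙 (inside  ∷ p) = cong suc (∣p∣≡∑𝟙 p)
∣p∣≡∑𝟙 (outside ∷ p) = ∣p∣≡∑𝟙 p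

∣p∣≤∣q∣+∑𝟙[p∖q] : ∀ {n} (p q : Subset n) →
  ∣ p ∣ ≤ ∣ q ∣ + ∑[ v < n ] 𝟙 (lookup p v ∧ not (lookup q v))
∣p∣≤∣q∣+∑𝟙[p∖q] {n} p q = begin
  ∣ p ∣                                       ≡⟨ ∣p∣≡∑𝟙 p ⟩
  ∑[ v < n ] 𝟙 (lookup p v)                   ≤⟨ ∑-mono-≤ (λ v → split (lookup p v) (lookup q v)) ⟩
  ∑[ v < n ] (𝟙 (lookup q v) + p∖q v)         ≡⟨ ∑-distrib-+ (𝟙 ∘ lookup q) p∖q ⟩
  ∑[ v < n ] 𝟙 (lookup q v) + ∑[ v < n ] p∖q v ≡⟨ cong (_+ ∑[ v < n ] p∖q v) (∣p∣≡∑𝟙 q) ⟨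
  ∣ q ∣ + ∑[ v < n ] p∖q v                    ∎
  where
  open ≤-Reasoning
  split : ∀ x y → 𝟙 x ≤ 𝟙 y + 𝟙 (x ∧ not y)
  split false y     = z≤n
  split true  true  = ≤-refl
  split true  false = ≤-refl
  p∖q : Fin n → ℕ
  p∖q v = 𝟙 (lookup p v ∧ not (lookup q v))

suc∣p[x]≔outside∣≡∣p∣ : ∀ {n} (p : Subset n) x → lookup p x ≡ inside → suc ∣ p [ x ]≔ outside ∣ ≡ ∣ p ∣
suc∣p[x]≔outside∣≡∣p∣ (inside  ∷ p) Fin.zero    _   = refl
suc∣p[x]≔outside∣≡∣p∣ (inside  ∷ p) (Fin.suc x) x∈p = cong suc (suc∣p[x]≔outside∣≡∣p∣ p x x∈p)
suc∣p[x]≔outside∣≡∣p∣ (outside ∷ p) (Fin.suc x) x∈p = suc∣p[x]≔outside∣≡∣p∣ p x x∈p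

∑ₛ : ∀ {n} → (Subset n → ℕ) → ℕ
∑ₛ {zero}  f = f []
∑ₛ {suc n} f = ∑ₛ (f ∘ (inside ∷_)) + ∑ₛ (f ∘ (outside ∷_))

∑ₛ-cong : ∀ {n} {f g : Subset n → ℕ} → (∀ S → f S ≡ g S) → ∑ₛ f ≡ ∑ₛ g
∑ₛ-cong {zero}  f≡g = f≡g []
∑ₛ-cong {suc n} f≡g = cong₂ _+_ (∑ₛ-cong (f≡g ∘ (inside ∷_))) (∑ₛ-cong (f≡g ∘ (outside ∷_)))

∑ₛ-mono-≤ : ∀ {n} {f g : Subset n → ℕ} → (∀ S → f S ≤ g S) → ∑ₛ f ≤ ∑ₛ g
∑ₛ-mono-≤ {zero}  f≤g = f≤g []
∑ₛ-mono-≤ {suc n} f≤g = +-mono-≤ (∑ₛ-mono-≤ (f≤g ∘ (inside ∷_))) (∑ₛ-mono-≤ (f≤g ∘ (outside ∷_)))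

∑ₛ-zero : ∀ {n} {f : Subset n → ℕ} → (∀ S → f S ≡ 0) → ∑ₛ f ≡ 0
∑ₛ-zero {zero}  f≡0 = f≡0 []
∑ₛ-zero {suc n} f≡0 = cong₂ _+_ (∑ₛ-zero (f≡0 ∘ (inside ∷_))) (∑ₛ-zero (f≡0 ∘ (outside ∷_)))

*-distribˡ-∑ₛ : ∀ {n} c (f : Subset n → ℕ) → c * ∑ₛ f ≡ ∑ₛ (λ S → c * f S)
*-distribˡ-∑ₛ {zero}  c f = refl
*-distribˡ-∑ₛ {suc n} c f = trans (*-distribˡ-+ c (∑ₛ (f ∘ (inside ∷_))) (∑ₛ (f ∘ (outside ∷_))))
  (cong₂ _+_ (*-distribˡ-∑ₛ c (f ∘ (inside ∷_))) (*-distribˡ-∑ₛ c (f ∘ (outside ∷_))))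

∑ₛ-∑-comm : ∀ {n m} (f : Subset n → Fin m → ℕ) →
  ∑ₛ (λ S → ∑[ v < m ] f S v) ≡ ∑[ v < m ] ∑ₛ (λ S → f S v)
∑ₛ-∑-comm {zero}      f = refl
∑ₛ-∑-comm {suc n} {m} f = trans
  (cong₂ _+_ (∑ₛ-∑-comm (f ∘ (inside ∷_))) (∑ₛ-∑-comm (f ∘ (outside ∷_))))
  (sym (∑-distrib-+ (λ v → ∑ₛ (λ S → f (inside ∷ S) v)) (λ v → ∑ₛ (λ S → f (outside ∷ S) v))))

length-filter-map : ∀ {a b p} {A : Set a} {B : Set b} {P : Pred B p} (P? : Decidable P) (h : A → B) xs →
  length (filter P? (map h xs)) ≡ length (filter (P? ∘ h) xs)
length-filter-map P? h List.[]       = refl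
length-filter-map P? h (x List.∷ xs) with does (P? (h x))
... | true  = cong suc (length-filter-map P? h xs)
... | false = length-filter-map P? h xs

length-filter-allSubsets : ∀ {p} n {P : Pred (Subset n) p} (P? : Decidable P) →
  length (filter P? (allSubsets n)) ≡ ∑ₛ (λ S → 𝟙 (does (P? S)))
length-filter-allSubsets zero P? with does (P? [])
... | true  = refl
... | false = refl
length-filter-allSubsets (suc n) P? = begin
  length (filter P? (map (inside ∷_) L ++ map (outside ∷_) L))
    ≡⟨ cong length (filter-++ P? (map (inside ∷_) L) (map (outside ∷_) L)) ⟩
  length (filter P? (map (inside ∷_) L) ++ filter P? (map (outside ∷_) L))
    ≡⟨ length-++ (filter P? (map (inside ∷_) L)) ⟩
  length (filter P? (map (inside ∷_) L)) + length (filter P? (map (outside ∷_) L))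
    ≡⟨ cong₂ _+_ (length-filter-map P? (inside ∷_) L) (length-filter-map P? (outside ∷_) L) ⟩
  length (filter (P? ∘ (inside ∷_)) L) + length (filter (P? ∘ (outside ∷_)) L)
    ≡⟨ cong₂ _+_ (length-filter-allSubsets n (P? ∘ (inside ∷_))) (length-filter-allSubsets n (P? ∘ (outside ∷_))) ⟩
  ∑ₛ (λ S → 𝟙 (does (P? S))) ∎
  where
  open ≡-Reasoning
  L = allSubsets n

-- S ↦ S [ v ]≔ outside is a bijection from the subsets containing v onto those avoiding it.
∑ₛ-remove : ∀ {n} (v : Fin n) (b : Subset n → ℕ) →
  ∑ₛ (λ S → 𝟙 (lookup S v) * b (S [ v ]≔ outside)) ≡ ∑ₛ (λ T → 𝟙 (lookup (∁ T) v) * b T)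
∑ₛ-remove {suc n} Fin.zero    b = +-comm (∑ₛ (λ S → 1 * b (outside ∷ S))) (∑ₛ {n} (λ _ → 0))
∑ₛ-remove         (Fin.suc v) b = cong₂ _+_ (∑ₛ-remove v (b ∘ (inside ∷_))) (∑ₛ-remove v (b ∘ (outside ∷_)))

∑ₛ-∑-remove : ∀ {n} (b : Subset n → ℕ) →
  ∑ₛ (λ S → ∑[ v < n ] (𝟙 (lookup S v) * b (S [ v ]≔ outside))) ≡ ∑ₛ (λ T → ∣ ∁ T ∣ * b T)
∑ₛ-∑-remove {n} b = begin
  ∑ₛ (λ S → ∑[ v < n ] (𝟙 (lookup S v) * b (S [ v ]≔ outside)))
    ≡⟨ ∑ₛ-∑-comm (λ S v → 𝟙 (lookup S v) * b (S [ v ]≔ outside)) ⟩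
  ∑[ v < n ] ∑ₛ (λ S → 𝟙 (lookup S v) * b (S [ v ]≔ outside))
    ≡⟨ sum-cong-≗ (λ v → ∑ₛ-remove v b) ⟩
  ∑[ v < n ] ∑ₛ (λ T → 𝟙 (lookup (∁ T) v) * b T)
    ≡⟨ ∑ₛ-∑-comm (λ T v → 𝟙 (lookup (∁ T) v) * b T) ⟨
  ∑ₛ (λ T → ∑[ v < n ] (𝟙 (lookup (∁ T) v) * b T))
    ≡⟨ ∑ₛ-cong (λ T → *-distribʳ-sum (b T) (𝟙 ∘ lookup (∁ T))) ⟨
  ∑ₛ (λ T → (∑[ v < n ] 𝟙 (lookup (∁ T) v)) * b T)
    ≡⟨ ∑ₛ-cong (λ T → cong (_* b T) (∣p∣≡∑𝟙 (∁ T))) ⟨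
  ∑ₛ (λ T → ∣ ∁ T ∣ * b T) ∎
  where open ≡-Reasoning

minimal-⊆ : ∀ {n p} {P : Pred (Subset n) p} → Decidable P → ∀ {S} → P S →
  ∃[ M ] M ⊆ S × P M × (∀ W → W ⊂ M → ¬ P W)
minimal-⊆ {P = P} P? {S} PS = go S (<-wellFounded ∣ S ∣) PS
  where
  go : ∀ S → Acc _<_ ∣ S ∣ → P S → ∃[ M ] M ⊆ S × P M × (∀ W → W ⊂ M → ¬ P W)
  go S (acc rec) PS with anySubset? (λ W → W ⊂? S ×-dec P? W)
  ... | yes (W , W⊂S , PW) =
    let M , M⊆W , PM , M-minimal = go W (rec (p⊂q⇒∣p∣<∣q∣ W⊂S)) PW
    in  M , ⊆-trans M⊆W (proj₁ W⊂S) , PM , M-minimal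
  ... | no ∄W = S , ⊆-refl , PS , λ W W⊂S PW → ∄W (W , W⊂S , PW)

n∸i≤r : ∀ {n Γ i r} → n + Γ ≤ 2 * i + 1 → suc i ≤ Γ + r → n ∸ i ≤ r
n∸i≤r {n} {Γ} {i} {r} n+Γ≤2i+1 1+i≤Γ+r = m≤n+o⇒m∸n≤o n i (+-cancelʳ-≤ Γ n (i + r) (begin
  n + Γ        ≤⟨ n+Γ≤2i+1 ⟩
  2 * i + 1    ≡⟨ reassoc₁ i ⟩
  i + suc i    ≤⟨ +-monoʳ-≤ i 1+i≤Γ+r ⟩
  i + (Γ + r)  ≡⟨ reassoc₂ i Γ r ⟩
  i + r + Γ    ∎))
  where
  open ≤-Reasoning
  reassoc₁ : ∀ i → 2 * i + 1 ≡ i + suc i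
  reassoc₁ = solve-∀
  reassoc₂ : ∀ i Γ r → i + (Γ + r) ≡ i + r + Γ
  reassoc₂ = solve-∀

module _ {n} (G : Graph n) where

  ⊆-dominating : ∀ {W U} → W ⊆ U → Dominating G W → Dominating G U
  ⊆-dominating W⊆U W-dom v with W-dom v
  ... | inj₁ v∈W           = inj₁ (W⊆U v∈W)
  ... | inj₂ (u , u∈W , uv) = inj₂ (u , W⊆U u∈W , uv)

  dominatingOfSize? : ∀ i → Decidable (λ U → Dominating G U × ∣ U ∣ ≡ i)
  dominatingOfSize? i U = dominating? G U ×-dec (∣ U ∣ ≟ i)

  𝟙D : ℕ → Subset n → ℕ
  𝟙D i U = 𝟙 (does (dominatingOfSize? i U))

  d≡∑ₛ𝟙D : ∀ i → d i G ≡ ∑ₛ (𝟙D i)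
  d≡∑ₛ𝟙D i = length-filter-allSubsets n (dominatingOfSize? i)

  d≡0 : ∀ {i} → n < i → d i G ≡ 0
  d≡0 {i} n<i = trans (d≡∑ₛ𝟙D i) (∑ₛ-zero λ U →
    cong 𝟙 (dec-false (dominatingOfSize? i U) λ (_ , ∣U∣≡i) → <⇒≱ n<i (subst (_≤ n) ∣U∣≡i (∣p∣≤n U))))

  removable : ℕ → Subset n → ℕ
  removable i S = ∑[ v < n ] (𝟙 (lookup S v) * 𝟙D i (S [ v ]≔ outside))

  ∣S∣≤∣M∣+removable : ∀ {i S M} → ∣ S ∣ ≡ suc i → M ⊆ S → Dominating G M → ∣ S ∣ ≤ ∣ M ∣ + removable i S
  ∣S∣≤∣M∣+removable {i} {S} {M} ∣S∣≡1+i M⊆S M-dom =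
    ≤-trans (∣p∣≤∣q∣+∑𝟙[p∖q] S M) (+-monoʳ-≤ ∣ M ∣ (∑-mono-≤ removable-if-∉M))
    where
    removable-if-∉M : ∀ v → 𝟙 (lookup S v ∧ not (lookup M v)) ≤ 𝟙 (lookup S v) * 𝟙D i (S [ v ]≔ outside)
    removable-if-∉M v with lookup S v in v∈S | lookup M v in v∉M
    ... | false | _     = z≤n
    ... | true  | true  = z≤n
    ... | true  | false = ≤-reflexive (sym (trans (+-identityʳ _) (cong 𝟙 (dec-true (dominatingOfSize? i _) S-v∈D))))
      where
      M⊆S-v : M ⊆ S [ v ]≔ outside
      M⊆S-v {y} y∈M = []≔-minimal S y v (λ { refl → contradiction (trans (sym ([]=⇒lookup y∈M)) v∉M) λ () }) (M⊆S y∈M)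
      S-v∈D : Dominating G (S [ v ]≔ outside) × ∣ S [ v ]≔ outside ∣ ≡ i
      S-v∈D = ⊆-dominating M⊆S-v M-dom , suc-injective (trans (suc∣p[x]≔outside∣≡∣p∣ S v v∈S) ∣S∣≡1+i)

  n∸i≤removable : ∀ {Γ i S} → IsUpperDominationNumber G Γ → n + Γ ≤ 2 * i + 1 →
    Dominating G S × ∣ S ∣ ≡ suc i → n ∸ i ≤ removable i S
  n∸i≤removable {Γ} {i} {S} (_ , Γ-max) n+Γ≤2i+1 (S-dom , ∣S∣≡1+i) =
    let M , M⊆S , M-dom , M-minimal = minimal-⊆ (dominating? G) S-dom
    in  n∸i≤r n+Γ≤2i+1 (begin
          suc i                  ≡⟨ ∣S∣≡1+i ⟨
          ∣ S ∣                  ≤⟨ ∣S∣≤∣M∣+removable ∣S∣≡1+i M⊆S M-dom ⟩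
          ∣ M ∣ + removable i S  ≤⟨ +-monoˡ-≤ (removable i S) (Γ-max M (M-dom , M-minimal)) ⟩
          Γ + removable i S      ∎)
    where open ≤-Reasoning

  [n∸i]*d[1+i]≤[n∸i]*d[i] : ∀ {Γ i} → IsUpperDominationNumber G Γ → n + Γ ≤ 2 * i + 1 →
    (n ∸ i) * d (suc i) G ≤ (n ∸ i) * d i G
  [n∸i]*d[1+i]≤[n∸i]*d[i] {Γ} {i} isΓ n+Γ≤2i+1 = begin
    (n ∸ i) * d (suc i) G                 ≡⟨ cong ((n ∸ i) *_) (d≡∑ₛ𝟙D (suc i)) ⟩
    (n ∸ i) * ∑ₛ (𝟙D (suc i))             ≡⟨ *-distribˡ-∑ₛ (n ∸ i) (𝟙D (suc i)) ⟩
    ∑ₛ (λ S → (n ∸ i) * 𝟙D (suc i) S)     ≤⟨ ∑ₛ-mono-≤ (λ S → *-𝟙-≤ (dominatingOfSize? (suc i) S) (n∸i≤removable isΓ n+Γ≤2i+1)) ⟩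
    ∑ₛ (removable i)                      ≡⟨ ∑ₛ-∑-remove (𝟙D i) ⟩
    ∑ₛ (λ T → ∣ ∁ T ∣ * 𝟙D i T)           ≡⟨ ∑ₛ-cong (λ T → *-𝟙-cong (dominatingOfSize? i T) (∣∁T∣≡n∸i T)) ⟩
    ∑ₛ (λ T → (n ∸ i) * 𝟙D i T)           ≡⟨ *-distribˡ-∑ₛ (n ∸ i) (𝟙D i) ⟨
    (n ∸ i) * ∑ₛ (𝟙D i)                   ≡⟨ cong ((n ∸ i) *_) (d≡∑ₛ𝟙D i) ⟨
    (n ∸ i) * d i G                       ∎
    where
    open ≤-Reasoning
    ∣∁T∣≡n∸i : ∀ T → Dominating G T × ∣ T ∣ ≡ i → ∣ ∁ T ∣ ≡ n ∸ i
    ∣∁T∣≡n∸i T (_ , ∣T∣≡i) = trans (∣∁p∣≡n∸∣p∣ T) (cong (n ∸_) ∣T∣≡i)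

theorem6p2 : ∀ {n} (G : Graph n) (Γ i : ℕ) → IsUpperDominationNumber G Γ →
    n + Γ ≤ 2 * i + 1 → d (i + 1) G ≤ d i G
theorem6p2 {n} G Γ i isΓ n+Γ≤2i+1 rewrite +-comm i 1 with i <? n
... | yes i<n = *-cancelˡ-≤ (n ∸ i) {{>-nonZero (m<n⇒0<n∸m i<n)}} ([n∸i]*d[1+i]≤[n∸i]*d[i] G {i = i} isΓ n+Γ≤2i+1)
... | no  i≮n = ≤-trans (≤-reflexive (d≡0 G (s≤s (≮⇒≥ i≮n)))) z≤n
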